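{- Let $m$ be a positive integer with $m\equiv 29\pmod{32}$, let $j$ be a nonnegative integer, and let $\ell=\lceil\log_2(m+j)\rceil$. Then $$\mathfrak{K}_j(m)<2^{\ell+1}+\frac{20\cdot 2^\ell-j}{m}.$$
   Context: The Thue–Morse word $\mathbf{t}=\mathbf{t}_1\mathbf{t}_2\mathbf{t}_3\cdots=0110100110010110\cdots$ is the infinite binary word whose $i$-th letter $\mathbf{t}_i$ ($i\ge 1$) is the parity of the number of 1's in the binary expansion of $i-1$. A $k$-anti-power is a word $w^{(1)}\cdots w^{(k)}$ with $w^{(1)},\dots,w^{(k)}$ pairwise distinct words of the same length. For $j\ge0$, the $j$-fix of $\mathbf{t}$ of length $N$ is $\mathbf{t}_{j+1}\cdots\mathbf{t}_{j+N}$. For a positive integer $m$, $\mathfrak{K}_j(m)$ is the smallest positive integer $k$ such that the $j$-fix of $\mathbf{t}$ of length $km$ is not a $k$-anti-power. -}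

module Defs where

open import Data.Bool using (Bool; true; false; not)
open import Data.Nat using (ℕ; zero; suc; _+_; _*_; _<_; _≤_)
open import Data.Nat.DivMod using (_/_; _%_)
open import Data.List using (List; map; upTo)
open import Relation.Binary.PropositionalEquality using (_≡_; _≢_)
open import Relation.Nullary using (¬_)

-- parity of the number of 1's in the binary expansion of n, with fuel
-- (fuel n suffices since n / 2 < n for n > 0)
parityFuel : ℕ → ℕ → Bool
parityFuel zero    n = false
parityFuel (suc f) n with n % 2
... | zero  = parityFuel f (n / 2)
... | suc _ = not (parityFuel f (n / 2))

-- parity of the binary digit sum of n (false = 0, true = 1)
binParity : ℕ → Bool
binParity n = parityFuel n n

-- Thue–Morse letter t_i (1-indexed): parity of number of 1's of i - 1.
-- We use the 0-indexed version tm n = t_{n+1}.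
tm : ℕ → Bool
tm n = binParity n

-- The j-fix of t of length N: t_{j+1} ⋯ t_{j+N}
jfix : ℕ → ℕ → List Bool
jfix j N = map (λ r → tm (j + r)) (upTo N)

-- the i-th block (0-indexed) of length m of the j-fix of length k*m:
-- w^{(i+1)} = t_{j+im+1} ⋯ t_{j+im+m}
block : (j m i : ℕ) → List Bool
block j m i = jfix (j + i * m) m

IsAntiPowerFix : (j m k : ℕ) → Set
IsAntiPowerFix j m k = ∀ i i' → i < i' → i' < k → block j m i ≢ block j m i'

IsKfrak : (j m K : ℕ) → Set
IsKfrak j m K =
  (1 ≤ K) × (¬ IsAntiPowerFix j m K) × (∀ k → 1 ≤ k → k < K → IsAntiPowerFix j m k)
  where open import Data.Product using (_×_)

module Submission where

-- Write N = 2^n. The key property of the Thue–Morse word is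
--   t(x + c·N) = t(c) xor t(x)   for x < N,
-- i.e. the binary digits of x + c·N are those of x followed by those of c.
-- Hence two length-m windows starting at x + a·N and x + b·N (with x + m ≤ N)
-- coincide as soon as t(a) = t(b). Shifting a block of the j-fix by N blocks
-- moves its start by m·N, i.e. from x + a·N to x + (a + m)·N, so block i and
-- block i + N coincide whenever t(a) = t(a + m). For m ≡ 1 (mod 4) we have
-- t(m + 1) = t(m), so either a = 0 (if t(m) = 0) or a = 1 (if t(m) = 1)
-- works, provided the block starts in [a·N, (a+1)·N - m]. With N = 2^(ℓ+1)
-- and m + j ≤ 2^ℓ such a block exists early enough, and since anti-powerness
-- is decidable and downward closed, 𝔎_j(m) ≤ i + N + 1, which yields the bound.

open import Defs
open import Data.Bool using (Bool; true; false; not; _xor_)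
import Data.Bool as Bool
open import Data.Bool.Properties using (xor-identityʳ)
open import Data.Nat
open import Data.Nat.Properties
open import Data.Nat.DivMod
open import Data.Nat.Divisibility using (divides; divides-refl)
open import Data.Nat.Logarithm using (⌈log₂_⌉)
open import Data.Nat.Logarithm.Core using (⌈log2⌉)
open import Data.Nat.Tactic.RingSolver using (solve-∀)
open import Data.List using (map; applyUpTo; upTo; _∷_)
open import Data.List.Properties using (map-upTo) renaming (≡-dec to list-≡-dec)
open import Data.Product using (Σ; _×_; _,_)
open import Induction.WellFounded using (Acc; acc)
open import Relation.Binary.PropositionalEquality
open import Relation.Nullary using (¬_; Dec; yes; no)
open import Relation.Nullary.Decidable using (map′; ¬?)
open import Data.Empty using (⊥-elim)

flipIfOdd : ℕ → Bool → Bool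
flipIfOdd zero    b = b
flipIfOdd (suc _) b = not b

parityFuel-step : ∀ f n → parityFuel (suc f) n ≡ flipIfOdd (n % 2) (parityFuel f (n / 2))
parityFuel-step f n with n % 2
... | zero  = refl
... | suc _ = refl

parityFuel-zero : ∀ f → parityFuel f 0 ≡ false
parityFuel-zero zero    = refl
parityFuel-zero (suc f) = parityFuel-zero f

half≤ : ∀ f n → n ≤ suc f → n / 2 ≤ f
half≤ f zero    _         = z≤n
half≤ f (suc k) (s≤s k≤f) = ≤-trans (<⇒≤pred (m/n<m (suc k) 2 (s≤s (s≤s z≤n)))) k≤f

parityFuel-enough : ∀ f g n → n ≤ f → n ≤ g → parityFuel f n ≡ parityFuel g n
parityFuel-enough zero    g       zero _ _ = sym (parityFuel-zero g)
parityFuel-enough (suc f) zero    zero _ _ = parityFuel-zero (suc f)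
parityFuel-enough (suc f) (suc g) n  n≤f n≤g = begin
  parityFuel (suc f) n                      ≡⟨ parityFuel-step f n ⟩
  flipIfOdd (n % 2) (parityFuel f (n / 2))  ≡⟨ cong (flipIfOdd (n % 2)) (parityFuel-enough f g (n / 2) (half≤ f n n≤f) (half≤ g n n≤g)) ⟩
  flipIfOdd (n % 2) (parityFuel g (n / 2))  ≡⟨ parityFuel-step g n ⟨
  parityFuel (suc g) n                      ∎
  where open ≡-Reasoning

tm-unfold : ∀ n → tm n ≡ flipIfOdd (n % 2) (tm (n / 2))
tm-unfold n = begin
  parityFuel n n                            ≡⟨ parityFuel-enough n (suc n) n ≤-refl (n≤1+n n) ⟩
  parityFuel (suc n) n                      ≡⟨ parityFuel-step n n ⟩
  flipIfOdd (n % 2) (parityFuel n (n / 2))  ≡⟨ cong (flipIfOdd (n % 2)) (parityFuel-enough n (n / 2) (n / 2) (m/n≤m n 2) ≤-refl) ⟩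
  flipIfOdd (n % 2) (tm (n / 2))            ∎
  where open ≡-Reasoning

tm-digit : ∀ b z → b < 2 → tm (b + z * 2) ≡ tm b xor tm z
tm-digit b z b<2 = begin
  tm (b + z * 2)                                        ≡⟨ tm-unfold (b + z * 2) ⟩
  flipIfOdd ((b + z * 2) % 2) (tm ((b + z * 2) / 2))    ≡⟨ cong₂ flipIfOdd low high ⟩
  flipIfOdd b (tm z)                                    ≡⟨ flip≡xor b b<2 ⟩
  tm b xor tm z                                         ∎
  where
  open ≡-Reasoning
  low : (b + z * 2) % 2 ≡ b
  low = trans ([m+kn]%n≡m%n b z 2) (m<n⇒m%n≡m b<2)
  high : tm ((b + z * 2) / 2) ≡ tm z
  high = cong tm (trans (+-distrib-/-∣ʳ b (divides-refl z))
                        (cong₂ _+_ (m<n⇒m/n≡0 b<2) (m*n/n≡m z 2)))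
  flip≡xor : ∀ b → b < 2 → flipIfOdd b (tm z) ≡ tm b xor tm z
  flip≡xor zero          _ = refl
  flip≡xor (suc zero)    _ = refl
  flip≡xor (suc (suc _)) (s≤s (s≤s ()))

xor-swap : ∀ a b c → a xor (b xor c) ≡ b xor (a xor c)
xor-swap false b c = refl
xor-swap true false c = refl
xor-swap true true c = refl

-- Concatenation of binary expansions: the digits of x + c·2ⁿ (x < 2ⁿ) are
-- those of x followed by those of c, so the digit-sum parities add.
tm-concat : ∀ n c x → x < 2 ^ n → tm (x + c * 2 ^ n) ≡ tm c xor tm x
tm-concat zero c zero _ = trans (cong tm (*-identityʳ c)) (sym (xor-identityʳ (tm c)))
tm-concat zero c (suc x) (s≤s ())
tm-concat (suc n) c x x<2N = begin
  tm (x + c * 2 ^ suc n)                        ≡⟨ cong tm regroup ⟩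
  tm (x % 2 + (x / 2 + c * 2 ^ n) * 2)          ≡⟨ tm-digit (x % 2) (x / 2 + c * 2 ^ n) (m%n<n x 2) ⟩
  tm (x % 2) xor tm (x / 2 + c * 2 ^ n)         ≡⟨ cong (tm (x % 2) xor_) (tm-concat n c (x / 2) half<) ⟩
  tm (x % 2) xor (tm c xor tm (x / 2))          ≡⟨ xor-swap (tm (x % 2)) (tm c) (tm (x / 2)) ⟩
  tm c xor (tm (x % 2) xor tm (x / 2))          ≡⟨ cong (tm c xor_) (tm-digit (x % 2) (x / 2) (m%n<n x 2)) ⟨
  tm c xor tm (x % 2 + x / 2 * 2)               ≡⟨ cong (λ y → tm c xor tm y) (m≡m%n+[m/n]*n x 2) ⟨
  tm c xor tm x                                 ∎
  where
  open ≡-Reasoning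
  shape : ∀ a b c d → a + b * 2 + c * (2 * d) ≡ a + (b + c * d) * 2
  shape = solve-∀
  regroup : x + c * 2 ^ suc n ≡ x % 2 + (x / 2 + c * 2 ^ n) * 2
  regroup = trans (cong (_+ c * 2 ^ suc n) (m≡m%n+[m/n]*n x 2)) (shape (x % 2) (x / 2) c (2 ^ n))
  half< : x / 2 < 2 ^ n
  half< = *-cancelʳ-< _ (x / 2) (2 ^ n)
            (≤-<-trans (m/n*n≤m x 2) (subst (x <_) (*-comm 2 (2 ^ n)) x<2N))

-- For m ≡ 1 (mod 4) the last two binary digits of m and m + 1 are 01 and 10,
-- which have the same parity.
tm-suc-1mod4 : ∀ m → m % 4 ≡ 1 → tm (suc m) ≡ tm m
tm-suc-1mod4 m m%4 = begin
  tm (suc m)          ≡⟨ cong (λ k → tm (suc k)) m≡ ⟩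
  tm (2 + u * 2 ^ 2)  ≡⟨ tm-concat 2 u 2 (s≤s (s≤s (s≤s z≤n))) ⟩
  tm u xor true       ≡⟨ tm-concat 2 u 1 (s≤s (s≤s z≤n)) ⟨
  tm (1 + u * 2 ^ 2)  ≡⟨ cong tm m≡ ⟨
  tm m                ∎
  where
  open ≡-Reasoning
  u = m / 4
  m≡ : m ≡ 1 + u * 2 ^ 2
  m≡ = trans (m≡m%n+[m/n]*n m 4) (cong (_+ u * 4) m%4)

-- n ≤ 2^⌈log₂ n⌉, by the same well-founded recursion that defines ⌈log2⌉:
-- n + 2 ≤ 2·(⌈n/2⌉ + 1).
≤2^⌈log2⌉ : ∀ n (a : Acc _<_ n) → n ≤ 2 ^ ⌈log2⌉ n a
≤2^⌈log2⌉ zero          _        = z≤n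
≤2^⌈log2⌉ (suc zero)    _        = s≤s z≤n
≤2^⌈log2⌉ (suc (suc n)) (acc rs) =
  ≤-trans n+2≤ (*-monoʳ-≤ 2 (≤2^⌈log2⌉ (suc ⌈ n /2⌉) (rs (⌈n/2⌉<n n))))
  where
  c = ⌈ n /2⌉
  n≤c+c : n ≤ c + c
  n≤c+c = subst (_≤ c + c) (⌊n/2⌋+⌈n/2⌉≡n n) (+-monoˡ-≤ c (⌊n/2⌋≤⌈n/2⌉ n))
  double : ∀ c → 2 * suc c ≡ 2 + (c + c)
  double = solve-∀
  n+2≤ : 2 + n ≤ 2 * suc c
  n+2≤ = subst (2 + n ≤_) (sym (double c)) (+-monoʳ-≤ 2 n≤c+c)

≤2^⌈log₂⌉ : ∀ n → n ≤ 2 ^ ⌈log₂ n ⌉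
≤2^⌈log₂⌉ n = ≤2^⌈log2⌉ n _

2^[n+1]≡2^n+2^n : ∀ n → 2 ^ (n + 1) ≡ 2 ^ n + 2 ^ n
2^[n+1]≡2^n+2^n n = trans (^-distribˡ-+-* 2 n 1) (twice (2 ^ n))
  where
  twice : ∀ P → P * (2 * 1) ≡ P + P
  twice = solve-∀

applyUpTo-cong : ∀ {f g : ℕ → Bool} n → (∀ r → r < n → f r ≡ g r) →
  applyUpTo f n ≡ applyUpTo g n
applyUpTo-cong zero    _  = refl
applyUpTo-cong (suc n) eq =
  cong₂ _∷_ (eq 0 z<s) (applyUpTo-cong n (λ r r<n → eq (suc r) (s≤s r<n)))

jfix-cong : ∀ p p' m → (∀ r → r < m → tm (p + r) ≡ tm (p' + r)) → jfix p m ≡ jfix p' m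
jfix-cong p p' m eq = begin
  map (λ r → tm (p + r)) (upTo m)   ≡⟨ map-upTo _ m ⟩
  applyUpTo (λ r → tm (p + r)) m    ≡⟨ applyUpTo-cong m eq ⟩
  applyUpTo (λ r → tm (p' + r)) m   ≡⟨ map-upTo _ m ⟨
  map (λ r → tm (p' + r)) (upTo m)  ∎
  where open ≡-Reasoning

window-shift : ∀ n x m a b → x + m ≤ 2 ^ n → tm a ≡ tm b →
  jfix (x + a * 2 ^ n) m ≡ jfix (x + b * 2 ^ n) m
window-shift n x m a b x+m≤N ta≡tb = jfix-cong (x + a * 2 ^ n) (x + b * 2 ^ n) m letter
  where
  shape : ∀ x a N r → x + a * N + r ≡ (x + r) + a * N
  shape = solve-∀
  letter : ∀ r → r < m → tm (x + a * 2 ^ n + r) ≡ tm (x + b * 2 ^ n + r)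
  letter r r<m = begin
    tm (x + a * 2 ^ n + r)    ≡⟨ cong tm (shape x a (2 ^ n) r) ⟩
    tm (x + r + a * 2 ^ n)    ≡⟨ tm-concat n a (x + r) x+r<N ⟩
    tm a xor tm (x + r)       ≡⟨ cong (_xor tm (x + r)) ta≡tb ⟩
    tm b xor tm (x + r)       ≡⟨ tm-concat n b (x + r) x+r<N ⟨
    tm (x + r + b * 2 ^ n)    ≡⟨ cong tm (shape x b (2 ^ n) r) ⟨
    tm (x + b * 2 ^ n + r)    ∎
    where
    open ≡-Reasoning
    x+r<N : x + r < 2 ^ n
    x+r<N = <-≤-trans (+-monoʳ-< x r<m) x+m≤N

-- Shifting block i of the j-fix by 2ⁿ blocks moves its start from
-- x + a·2ⁿ to x + (a + m)·2ⁿ; so the two blocks agree when t(a) = t(a + m).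
block-shift : ∀ n j m i x a → j + i * m ≡ x + a * 2 ^ n → x + m ≤ 2 ^ n →
  tm a ≡ tm (a + m) → block j m i ≡ block j m (i + 2 ^ n)
block-shift n j m i x a start x+m≤N ta≡ta+m = begin
  jfix (j + i * m) m                ≡⟨ cong (λ p → jfix p m) start ⟩
  jfix (x + a * 2 ^ n) m            ≡⟨ window-shift n x m a (a + m) x+m≤N ta≡ta+m ⟩
  jfix (x + (a + m) * 2 ^ n) m      ≡⟨ cong (λ p → jfix p m) shifted ⟨
  jfix (j + (i + 2 ^ n) * m) m      ∎
  where
  open ≡-Reasoning
  split : ∀ j i N m → j + (i + N) * m ≡ (j + i * m) + m * N
  split = solve-∀
  merge : ∀ x a N m → x + a * N + m * N ≡ x + (a + m) * N
  merge = solve-∀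
  shifted : j + (i + 2 ^ n) * m ≡ x + (a + m) * 2 ^ n
  shifted = trans (split j i (2 ^ n) m)
              (trans (cong (_+ m * 2 ^ n) start) (merge x a (2 ^ n) m))

multiple-after : ∀ d m .{{_ : NonZero m}} → Σ ℕ λ i → d < i * m × i * m ≤ d + m
multiple-after d m = suc q , d<m+qm , subst (m + q * m ≤_) (+-comm m d) (+-monoʳ-≤ m (m/n*n≤m d m))
  where
  q = d / m
  d<m+qm : d < m + q * m
  d<m+qm = subst (_< m + q * m) (sym (m≡m%n+[m/n]*n d m)) (+-monoˡ-< (q * m) (m%n<n d m))

block-start-after : ∀ N j m .{{_ : NonZero m}} → j ≤ N →
  Σ ℕ λ i → N < j + i * m × j + i * m ≤ N + m
block-start-after N j m j≤N with multiple-after (N ∸ j) m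
... | i , d<im , im≤d+m =
  i , subst (_< j + i * m) (m+[n∸m]≡n j≤N) (+-monoʳ-< j d<im)
    , subst (j + i * m ≤_) (trans (sym (+-assoc j (N ∸ j) m)) (cong (_+ m) (m+[n∸m]≡n j≤N)))
        (+-monoʳ-≤ j im≤d+m)

-- For m ≡ 1 (mod 4) and 2ⁿ ≥ max(2m, j + m), block i and block i + 2ⁿ of
-- the j-fix coincide for some i whose block ends by 2·2ⁿ: take a = 0 when
-- t(m) = 0 (block 0), and a = 1 when t(m) = 1 = t(m + 1) (a block starting
-- in (2ⁿ, 2ⁿ + m]).
repeated-block : ∀ n j m .{{_ : NonZero m}} → m % 4 ≡ 1 → m + m ≤ 2 ^ n → j + m ≤ 2 ^ n →
  Σ ℕ λ i → block j m i ≡ block j m (i + 2 ^ n) × j + i * m + m ≤ 2 ^ n + 2 ^ n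
repeated-block n j m m%4 m+m≤N j+m≤N with tm m in tm-m
... | false = 0 , block-shift n j m 0 j 0 refl j+m≤N (sym tm-m)
                , ≤-trans (≤-reflexive (cong (_+ m) (+-identityʳ j))) (≤-trans j+m≤N (m≤m+n _ _))
... | true with block-start-after (2 ^ n) j m (m+n≤o⇒m≤o j j+m≤N)
...   | i , N<start , start≤ = i , block-shift n j m i x 1 start x+m≤N tm1≡tm[1+m] , end≤
  where
  N = 2 ^ n
  end≤ : j + i * m + m ≤ N + N
  end≤ = ≤-trans (+-monoˡ-≤ m start≤) (≤-trans (≤-reflexive (+-assoc N m m)) (+-monoʳ-≤ N m+m≤N))
  x = j + i * m ∸ N
  x+N≡start : x + N ≡ j + i * m
  x+N≡start = m∸n+n≡m (<⇒≤ N<start)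
  start : j + i * m ≡ x + 1 * N
  start = trans (sym x+N≡start) (cong (x +_) (sym (+-identityʳ N)))
  shuffle : ∀ x m N → x + m + N ≡ x + N + m
  shuffle = solve-∀
  x+m≤N : x + m ≤ N
  x+m≤N = +-cancelʳ-≤ N (x + m) N
            (subst (_≤ N + N) (sym (trans (shuffle x m N) (cong (_+ m) x+N≡start))) end≤)
  tm1≡tm[1+m] : tm 1 ≡ tm (1 + m)
  tm1≡tm[1+m] = sym (trans (tm-suc-1mod4 m m%4) tm-m)

first-failure : {P : ℕ → Set} → (∀ k → Dec (P k)) → (∀ {k k'} → k' ≤ k → P k → P k') →
  P 0 → ∀ k → ¬ P k →
  Σ ℕ λ K → K ≤ k × (1 ≤ K × ¬ P K × (∀ k' → 1 ≤ k' → k' < K → P k'))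
first-failure P? down P0 zero    ¬P0 = ⊥-elim (¬P0 P0)
first-failure P? down P0 (suc k) ¬Pk+1 with P? k
... | yes Pk = suc k , ≤-refl , s≤s z≤n , ¬Pk+1 , λ k' _ k'<k+1 → down (s≤s⁻¹ k'<k+1) Pk
... | no ¬Pk with first-failure P? down P0 k ¬Pk
...   | K , K≤k , first = K , m≤n⇒m≤1+n K≤k , first

antiPower? : ∀ j m k → Dec (IsAntiPowerFix j m k)
antiPower? j m k = map′ fromNew toNew (allUpTo? new? k)
  where
  New : ℕ → Set
  New i' = ∀ {i} → i < i' → block j m i ≢ block j m i'
  new? : ∀ i' → Dec (New i')
  new? i' = allUpTo? (λ i → ¬? (list-≡-dec Bool._≟_ (block j m i) (block j m i'))) i'
  fromNew : (∀ {i'} → i' < k → New i') → IsAntiPowerFix j m k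
  fromNew h i i' i<i' i'<k = h i'<k i<i'
  toNew : IsAntiPowerFix j m k → ∀ {i'} → i' < k → New i'
  toNew ap i'<k i<i' = ap _ _ i<i' i'<k

antiPower-down : ∀ j m {k k'} → k' ≤ k → IsAntiPowerFix j m k → IsAntiPowerFix j m k'
antiPower-down j m k'≤k ap i i' i<i' i'<k' = ap i i' i<i' (<-≤-trans i'<k' k'≤k)

repetition⇒Kfrak : ∀ j m i i' → i < i' → block j m i ≡ block j m i' →
  Σ ℕ λ K → K ≤ suc i' × IsKfrak j m K
repetition⇒Kfrak j m i i' i<i' same =
  first-failure (antiPower? j m) (antiPower-down j m) (λ _ _ _ ()) (suc i')
    (λ ap → ap i i' i<i' ≤-refl same)

Kfrak-estimate : ∀ K i m j N P → N ≡ P + P → 0 < P → K ≤ suc (i + N) →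
  j + i * m + m ≤ N + N → K * m + j < N * m + 20 * P
Kfrak-estimate K i m j N P N≡2P P>0 K≤ end≤ = begin-strict
  K * m + j                 ≤⟨ +-monoˡ-≤ j (*-monoˡ-≤ m K≤) ⟩
  suc (i + N) * m + j       ≡⟨ regroup i N m j ⟩
  N * m + (j + i * m + m)   ≤⟨ +-monoʳ-≤ (N * m) end≤ ⟩
  N * m + (N + N)           ≡⟨ cong (λ M → N * m + (M + M)) N≡2P ⟩
  N * m + (P + P + (P + P)) ≡⟨ cong (N * m +_) (quadruple P) ⟩
  N * m + 4 * P             <⟨ +-monoʳ-< (N * m) (*-monoˡ-< P {{>-nonZero P>0}} {4} {20} (s≤s (s≤s (s≤s (s≤s (s≤s z≤n)))))) ⟩
  N * m + 20 * P            ∎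
  where
  open ≤-Reasoning
  regroup : ∀ i N m j → suc (i + N) * m + j ≡ N * m + (j + i * m + m)
  regroup = solve-∀
  quadruple : ∀ P → P + P + (P + P) ≡ 4 * P
  quadruple = solve-∀

mainTheorem14 : (m j : ℕ) → m % 32 ≡ 29 →
    Σ ℕ (λ K → IsKfrak j m K ×
    (K * m + j < 2 ^ (⌈log₂ (m + j)⌉ + 1) * m + 20 * 2 ^ ⌈log₂ (m + j)⌉))
mainTheorem14 zero        j ()
mainTheorem14 m@(suc _)   j m%32 =
  let i , same , end≤ = repeated-block (ℓ + 1) j m m%4 m+m≤N j+m≤N
      K , K≤ , isK    = repetition⇒Kfrak j m i (i + N) (m<m+n i (m^n>0 2 (ℓ + 1))) same
  in  K , isK , Kfrak-estimate K i m j N P N≡2P (m^n>0 2 ℓ) K≤ end≤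
  where
  ℓ = ⌈log₂ (m + j)⌉
  P = 2 ^ ℓ
  N = 2 ^ (ℓ + 1)
  N≡2P : N ≡ P + P
  N≡2P = 2^[n+1]≡2^n+2^n ℓ
  m+j≤P : m + j ≤ P
  m+j≤P = ≤2^⌈log₂⌉ (m + j)
  m≤P : m ≤ P
  m≤P = m+n≤o⇒m≤o m m+j≤P
  m%4 : m % 4 ≡ 1
  m%4 = trans (sym (m∣n⇒o%n%m≡o%m 4 32 m (divides 8 refl))) (cong (_% 4) m%32)
  m+m≤N : m + m ≤ N
  m+m≤N = subst (m + m ≤_) (sym N≡2P) (+-mono-≤ m≤P m≤P)
  j+m≤N : j + m ≤ N
  j+m≤N = subst (j + m ≤_) (sym N≡2P) (≤-trans (≤-reflexive (+-comm j m)) (≤-trans m+j≤P (m≤m+n P P)))
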